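{- For each $n>0$ and all proper $\alpha_1,\dots,\alpha_{n+1}\in2^\omega$ we have \[ s^{\oplus_n}_{\alpha_1,\dots,\alpha_n}\le_{sW} s^{\oplus_{n+1}}_{\alpha_1,\dots,\alpha_{n+1}} \quad\text{and}\quad s^{\oplus_{n+1}}_{\alpha_1,\dots,\alpha_{n+1}}\not\le_{W} s^{\oplus_n}_{\alpha_1,\dots,\alpha_n}. \]
   Context: Cantor space $2^\omega$ carries the lexicographic order $<_{lex}$. For $\alpha\in2^\omega$, $s_\alpha\colon 2^\omega\to\{0,1\}$ is $s_\alpha(x)=0$ if $x<_{lex}\alpha$ and $s_\alpha(x)=1$ if $x\ge_{lex}\alpha$. A sequence is proper if it contains infinitely many $1$'s. $\oplus_m$ denotes addition modulo $2$ of $m$ bits, and for $\alpha_1,\dots,\alpha_m\in2^\omega$, $s^{\oplus_m}_{\alpha_1,\dots,\alpha_m}\colon(2^\omega)^m\to\{0,1\}$ is $(x_1,\dots,x_m)\mapsto s_{\alpha_1}(x_1)\oplus\dots\oplus s_{\alpha_m}(x_m)$. $f\le_W g$ means there are computable functionals $\Phi,\Psi$ with $f(x)=\Psi(x,g(\Phi(x)))$ for all $x$ in the domain of $f$; $f\le_{sW} g$ means $f(x)=\Psi(g(\Phi(x)))$. -}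

module Defs where

open import Data.Nat using (ℕ; zero; suc; _<_; _≤_)
open import Data.Bool using (Bool; true; false; _xor_; if_then_else_)
open import Data.Fin using (Fin; fromℕ<; inject₁)
open import Data.Vec using (Vec; []; _∷_; lookup)
open import Data.Product using (Σ; _×_; _,_; ∃)
open import Data.Sum using (_⊎_)
open import Relation.Binary.PropositionalEquality using (_≡_)
open import Relation.Nullary using (¬_)
open import Relation.Nullary.Decidable using (Dec; yes; no)
open import Data.Nat using (_<?_)

Cantor : Set
Cantor = ℕ → Bool

_<lex_ : Cantor → Cantor → Set
x <lex y = Σ ℕ λ n → (∀ k → k < n → x k ≡ y k) × (x n ≡ false) × (y n ≡ true)

_≥lex_ : Cantor → Cantor → Set
x ≥lex y = (∀ k → x k ≡ y k) ⊎ (y <lex x)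

Proper : Cantor → Set
Proper α = ∀ n → Σ ℕ λ m → (n ≤ m) × (α m ≡ true)

-- Since <lex is not decidable constructively, s_α is given by its graph:
-- SGraph α x b  iff  s_α(x) = b.
SGraph : Cantor → Cantor → Bool → Set
SGraph α x false = x <lex α
SGraph α x true  = x ≥lex α

xorAll : (m : ℕ) → (Fin m → Bool) → Bool
xorAll zero    bs = false
xorAll (suc m) bs = bs Fin.zero xor xorAll m (λ i → bs (Fin.suc i))
  where import Data.Fin as Fin

-- a (single-valued, total) problem on (2^ω)^m with values in {0,1}, as a graph
Problem : ℕ → Set₁
Problem m = (Fin m → Cantor) → Bool → Set

sXor : (m : ℕ) → (Fin m → Cantor) → Problem m
sXor m αs xs b = Σ (Fin m → Bool) λ bs →
  (∀ i → SGraph (αs i) (xs i) (bs i)) × (xorAll m bs ≡ b)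

-- The oracle is a tuple of Cantor-space points,
-- queried by O(i , k) = i-th point's k-th bit (0 if i out of range).

Oracle : Set
Oracle = ℕ → ℕ → Bool

data PR : ℕ → Set where
  Z  : ∀ {n} → PR n
  S  : PR 1
  P  : ∀ {n} → Fin n → PR n
  O  : PR 2
  C  : ∀ {k n} → PR k → Vec (PR n) k → PR n
  R  : ∀ {n} → PR n → PR (suc (suc n)) → PR (suc n)
  M  : ∀ {n} → PR (suc n) → PR n

bitℕ : Bool → ℕ
bitℕ false = 0
bitℕ true  = 1

mutual
  data Eval (o : Oracle) : ∀ {n} → PR n → Vec ℕ n → ℕ → Set where
    eZ : ∀ {n} {xs : Vec ℕ n} → Eval o Z xs 0
    eS : ∀ {x} → Eval o S (x ∷ []) (suc x)
    eP : ∀ {n} {i : Fin n} {xs} → Eval o (P i) xs (lookup xs i)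
    eO : ∀ {i k} → Eval o O (i ∷ k ∷ []) (bitℕ (o i k))
    eC : ∀ {k n} {f : PR k} {gs : Vec (PR n) k} {xs ys v} →
         EvalV o gs xs ys → Eval o f ys v → Eval o (C f gs) xs v
    eR0 : ∀ {n} {f : PR n} {g} {xs v} →
          Eval o f xs v → Eval o (R f g) (0 ∷ xs) v
    eRS : ∀ {n} {f : PR n} {g} {y xs u v} →
          Eval o (R f g) (y ∷ xs) u → Eval o g (y ∷ u ∷ xs) v →
          Eval o (R f g) (suc y ∷ xs) v
    eM : ∀ {n} {f : PR (suc n)} {xs v} →
         Eval o f (v ∷ xs) 0 →
         (∀ y → y < v → Σ ℕ λ w → Eval o f (y ∷ xs) (suc w)) →
         Eval o (M f) xs v

  data EvalV (o : Oracle) {n : ℕ} : ∀ {k} → Vec (PR n) k → Vec ℕ n → Vec ℕ k → Set where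
    [] : ∀ {xs} → EvalV o [] xs []
    _∷_ : ∀ {k g} {gs : Vec (PR n) k} {xs y ys} →
          Eval o g xs y → EvalV o gs xs ys → EvalV o (g ∷ gs) xs (y ∷ ys)

toOracle : ∀ {m} → (Fin m → Cantor) → Oracle
toOracle {m} xs i k with i <? m
... | yes p = xs (fromℕ< p) k
... | no _  = false

noOracle : Oracle
noOracle _ _ = false

Computes : ∀ {m k} → PR 2 → ((Fin m → Cantor) → (Fin k → Cantor)) → Set
Computes {m} {k} φ Φ =
  ∀ xs (i : Fin k) j → Eval (toOracle xs) φ (Data.Fin.toℕ i ∷ j ∷ []) (bitℕ (Φ xs i j))
  where import Data.Fin

-- Weihrauch reducibility  F ≤_W G :
-- F(x) = Ψ(x , G(Φ(x))) with Φ, Ψ computable.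
_≤W_ : ∀ {m k} → Problem m → Problem k → Set
_≤W_ {m} {k} F G =
  Σ (PR 2) λ φ → Σ ((Fin m → Cantor) → (Fin k → Cantor)) λ Φ →
  Σ (PR 1) λ ψ →
    Computes φ Φ ×
    (∀ xs b → G (Φ xs) b →
       Σ Bool λ c → Eval (toOracle xs) ψ (bitℕ b ∷ []) (bitℕ c) × F xs c)

-- strong Weihrauch reducibility  F ≤_sW G :  F(x) = Ψ(G(Φ(x))).
_≤sW_ : ∀ {m k} → Problem m → Problem k → Set
_≤sW_ {m} {k} F G =
  Σ (PR 2) λ φ → Σ ((Fin m → Cantor) → (Fin k → Cantor)) λ Φ →
  Σ (PR 1) λ ψ →
    Computes φ Φ ×
    (∀ xs b → G (Φ xs) b →
       Σ Bool λ c → Eval noOracle ψ (bitℕ b ∷ []) (bitℕ c) × F xs c)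

-- For s⊕ₙ ≤sW s⊕ₙ₊₁, append the zero sequence as last argument: it lies
-- lexicographically below the proper αₙ₊₁, so it contributes the bit 0.
--
-- For the converse, suppose Φ, Ψ reduce s⊕ₘ (all αᵢ proper) to s⊕ₖ with k < m,
-- and start from x = (α₁,…,αₘ), where all m bits are 1. The answer of Ψ and
-- every 0 among the k inner bits s_βⱼ(Φ(x)ⱼ) depend only on a finite prefix of
-- x (a 0 is witnessed by a finite prefix of Φ(x)ⱼ). Switching off a 1 of an
-- untouched coordinate xᵢ = αᵢ beyond that prefix flips s⊕ₘ, so Ψ must receive
-- the other inner parity; as no inner 0 can become a 1, some inner 1 becomes a
-- 0. Each step uses up one of the m coordinates and one of the at most k inner
-- 1's, which cannot go on m times. The bits s_α(x) exist only under double
-- negation, so the argument runs in the double-negation monad.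

module Submission where

open import Defs
open import Data.Nat using (ℕ; zero; suc; _<_; _≤_; _+_; _⊔_; _<?_; _≟_)
open import Data.Nat.Induction using (<-rec)
open import Data.Nat.Properties
  using (≤-refl; ≤-reflexive; ≤-trans; <⇒≤; <⇒≢; <⇒≱; n≮n; n<1+n; m<n⇒m<1+n; m<1+n⇒m<n∨m≡n;
         m≤n⇒m≤1+n; m≤m⊔n; m≤n⊔m; <-cmp; +-suc; +-monoˡ-≤; +-identityʳ; m+n≤o⇒n≤o)
open import Data.Bool using (Bool; true; false; not; _xor_)
open import Data.Bool.Properties
  using (not-¬; not-distribˡ-xor; not-distribʳ-xor; xor-comm; xor-assoc; xor-identityʳ)
open import Data.Fin using (Fin; zero; suc; toℕ; fromℕ; fromℕ<; inject₁)
import Data.Fin.Properties as Fin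
open import Data.Fin.Subset using (Subset; _∈_; _∉_; _⊆_; _⊂_; ∣_∣)
open import Data.Fin.Subset.Properties using (_∈?_; ⊆-antisym; ∣p∣≤n; p⊂q⇒∣p∣<∣q∣)
open import Data.Vec using (Vec; []; _∷_; lookup)
open import Data.Vec.Properties using ([]=⇒lookup; lookup⇒[]=)
open import Data.Vec.Functional using (updateAt)
open import Data.Vec.Functional.Properties using (updateAt-updates; updateAt-minimal)
open import Data.Product using (Σ; _×_; _,_; proj₁; proj₂)
open import Data.Sum using (inj₁; inj₂; [_,_])
open import Data.Empty using (⊥)
open import Effect.Monad using (RawMonad)
open import Level using (0ℓ)
open import Relation.Binary using (tri<; tri≈; tri>)
open import Relation.Binary.PropositionalEquality
  using (_≡_; _≢_; refl; sym; trans; cong; cong₂; cong-app; subst; module ≡-Reasoning)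
open import Relation.Nullary using (¬_; yes; no; contradiction)
open import Relation.Nullary.Decidable using (_→-dec_)
open import Relation.Nullary.Negation using (¬¬-Monad)

open RawMonad (¬¬-Monad {0ℓ}) using (return; _>>=_)

Agree : {I : Set} → ℕ → (I → Cantor) → (I → Cantor) → Set
Agree N x y = ∀ i q → q < N → x i q ≡ y i q

agree-≤ : ∀ {I} {N₁ N₂} {x y : I → Cantor} → N₁ ≤ N₂ → Agree N₂ x y → Agree N₁ x y
agree-≤ N₁≤N₂ agree i q q<N₁ = agree i q (≤-trans q<N₁ N₁≤N₂)

Locally : {I : Set} → ((I → Cantor) → Set) → (I → Cantor) → Set
Locally Q x = Σ ℕ λ N → ∀ y → Agree N x y → Q y

module _ {I : Set} {x : I → Cantor} where

  locally-centre : ∀ {Q} → Locally Q x → Q x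
  locally-centre (_ , p) = p x (λ _ _ _ → refl)

  everywhere⇒locally : ∀ {Q} → (∀ y → Q y) → Locally Q x
  everywhere⇒locally p = 0 , λ y _ → p y

  locally-map : ∀ {Q Q′} → (∀ {y} → Q y → Q′ y) → Locally Q x → Locally Q′ x
  locally-map f (N , p) = N , λ y agree → f (p y agree)

  locally-zipWith : ∀ {Q Q′ Q″} → (∀ {y} → Q y → Q′ y → Q″ y) →
                    Locally Q x → Locally Q′ x → Locally Q″ x
  locally-zipWith f (N₁ , p) (N₂ , q) = N₁ ⊔ N₂ , λ y agree →
    f (p y (agree-≤ (m≤m⊔n N₁ N₂) agree)) (q y (agree-≤ (m≤n⊔m N₁ N₂) agree))

  locally-∀< : ∀ {Q : ℕ → (I → Cantor) → Set} L → (∀ q → q < L → Locally (Q q) x) →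
               Locally (λ y → ∀ q → q < L → Q q y) x
  locally-∀< zero    _ = everywhere⇒locally λ _ _ ()
  locally-∀< {Q} (suc L) p = locally-zipWith extend (p L (n<1+n L))
    (locally-∀< L λ q q<L → p q (m<n⇒m<1+n q<L))
    where
    extend : ∀ {y} → Q L y → (∀ q → q < L → Q q y) → ∀ q → q < suc L → Q q y
    extend atL below q q<1+L = [ below q , (λ { refl → atL }) ] (m<1+n⇒m<n∨m≡n q<1+L)

  locally-∀Fin : ∀ {n} {Q : Fin n → (I → Cantor) → Set} → (∀ j → Locally (Q j) x) →
                 Locally (λ y → ∀ j → Q j y) x
  locally-∀Fin {zero}  _ = everywhere⇒locally λ _ ()
  locally-∀Fin {suc n} p = locally-zipWith (λ p₀ pₛ → λ { zero → p₀ ; (suc j) → pₛ j })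
    (p zero) (locally-∀Fin λ j → p (suc j))

mutual
  eval-continuous : ∀ {o n} {c : PR n} {args v} → Eval o c args v →
                    Locally (λ o′ → Eval o′ c args v) o
  eval-continuous eZ = everywhere⇒locally λ _ → eZ
  eval-continuous eS = everywhere⇒locally λ _ → eS
  eval-continuous eP = everywhere⇒locally λ _ → eP
  eval-continuous (eO {i} {k}) = suc k , λ o′ agree →
    subst (λ b → Eval o′ O (i ∷ k ∷ []) (bitℕ b)) (sym (agree i k (n<1+n k))) eO
  eval-continuous (eC es e)  = locally-zipWith eC (evalV-continuous es) (eval-continuous e)
  eval-continuous (eR0 e)    = locally-map eR0 (eval-continuous e)
  eval-continuous (eRS e e′) = locally-zipWith eRS (eval-continuous e) (eval-continuous e′)
  eval-continuous (eM {v = v} e below) = locally-zipWith eM (eval-continuous e)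
    (locally-∀< v λ y y<v → eval-continuous-nonzero (below y y<v))

  eval-continuous-nonzero : ∀ {o n} {c : PR n} {args} → Σ ℕ (λ w → Eval o c args (suc w)) →
                            Locally (λ o′ → Σ ℕ λ w → Eval o′ c args (suc w)) o
  eval-continuous-nonzero (w , e) = locally-map (w ,_) (eval-continuous e)

  evalV-continuous : ∀ {o n k} {cs : Vec (PR n) k} {args vs} → EvalV o cs args vs →
                     Locally (λ o′ → EvalV o′ cs args vs) o
  evalV-continuous []       = everywhere⇒locally λ _ → []
  evalV-continuous (e ∷ es) = locally-zipWith _∷_ (eval-continuous e) (evalV-continuous es)

mutual
  eval-deterministic : ∀ {o n} {c : PR n} {args v w} → Eval o c args v → Eval o c args w → v ≡ w
  eval-deterministic eZ eZ = refl
  eval-deterministic eS eS = refl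
  eval-deterministic eP eP = refl
  eval-deterministic eO eO = refl
  eval-deterministic (eC es e) (eC es′ e′) with evalV-deterministic es es′
  ... | refl = eval-deterministic e e′
  eval-deterministic (eR0 e) (eR0 e′) = eval-deterministic e e′
  eval-deterministic (eRS e₁ e₂) (eRS e₁′ e₂′) with eval-deterministic e₁ e₁′
  ... | refl = eval-deterministic e₂ e₂′
  eval-deterministic (eM {v = v} e below) (eM {v = v′} e′ below′) with <-cmp v v′
  ... | tri≈ _ v≡v′ _ = v≡v′
  ... | tri< v<v′ _ _ with below′ v v<v′
  ...   | _ , e″ with eval-deterministic e e″
  ...     | ()
  eval-deterministic (eM e below) (eM e′ below′) | tri> _ _ v′<v with below _ v′<v
  ...   | _ , e″ with eval-deterministic e′ e″
  ...     | ()

  evalV-deterministic : ∀ {o n k} {cs : Vec (PR n) k} {args vs ws} →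
                        EvalV o cs args vs → EvalV o cs args ws → vs ≡ ws
  evalV-deterministic []       []         = refl
  evalV-deterministic (e ∷ es) (e′ ∷ es′) =
    cong₂ _∷_ (eval-deterministic e e′) (evalV-deterministic es es′)

bitℕ-injective : ∀ {a b} → bitℕ a ≡ bitℕ b → a ≡ b
bitℕ-injective {false} {false} _ = refl
bitℕ-injective {true}  {true}  _ = refl

toOracle-agree : ∀ {m N} {xs ys : Fin m → Cantor} → Agree N xs ys → Agree N (toOracle xs) (toOracle ys)
toOracle-agree {m} agree i q q<N with i <? m
... | yes _ = agree _ q q<N
... | no  _ = refl

locally-toOracle : ∀ {m} {xs : Fin m → Cantor} {Q : Oracle → Set} →
                   Locally Q (toOracle xs) → Locally (λ ys → Q (toOracle ys)) xs
locally-toOracle (N , q) = N , λ ys agree → q (toOracle ys) (toOracle-agree agree)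

toOracle-toℕ : ∀ {m} (xs : Fin m → Cantor) i q → toOracle xs (toℕ i) q ≡ xs i q
toOracle-toℕ {m} xs i q with toℕ i <? m
... | yes i<m = cong (λ j → xs j q) (Fin.fromℕ<-toℕ i i<m)
... | no  i≮m = contradiction (Fin.toℕ<n i) i≮m

toOracle-outside : ∀ {m} (xs : Fin m → Cantor) q → toOracle xs m q ≡ false
toOracle-outside {m} xs q with m <? m
... | yes m<m = contradiction m<m (n≮n m)
... | no  _   = refl

computable-continuous : ∀ {m k φ} {Φ : (Fin m → Cantor) → (Fin k → Cantor)} → Computes φ Φ →
                        ∀ xs i q → Locally (λ ys → Φ ys i q ≡ Φ xs i q) xs
computable-continuous computes xs i q = locally-map
  (λ {ys} e → bitℕ-injective (eval-deterministic (computes ys i q) e))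
  (locally-toOracle (eval-continuous (computes xs i q)))

<lex⇒≱lex : ∀ {x α} → x <lex α → ¬ (x ≥lex α)
<lex⇒≱lex (p , _ , xp≡0 , αp≡1) (inj₁ x≗α) with trans (sym xp≡0) (trans (x≗α p) αp≡1)
... | ()
<lex⇒≱lex (p , x≡α , xp≡0 , αp≡1) (inj₂ (q , α≡x , αq≡0 , xq≡1)) with <-cmp p q
... | tri< p<q _ _ with trans (sym αp≡1) (trans (α≡x p p<q) xp≡0)
...   | ()
<lex⇒≱lex (p , x≡α , xp≡0 , αp≡1) (inj₂ (q , α≡x , αq≡0 , xq≡1)) | tri≈ _ refl _
  with trans (sym xp≡0) xq≡1
...   | ()
<lex⇒≱lex (p , x≡α , xp≡0 , αp≡1) (inj₂ (q , α≡x , αq≡0 , xq≡1)) | tri> _ _ q<p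
  with trans (sym xq≡1) (trans (x≡α q q<p) αq≡0)
...   | ()

<lex-open : ∀ {x α} → x <lex α → Σ ℕ λ N → ∀ y → (∀ q → q < N → y q ≡ x q) → y <lex α
<lex-open (p , x≡α , xp≡0 , αp≡1) = suc p , λ y y≡x →
  p , (λ q q<p → trans (y≡x q (m≤n⇒m≤1+n q<p)) (x≡α q q<p)) , trans (y≡x p ≤-refl) xp≡0 , αp≡1

computable-<lex : ∀ {m k φ} {Φ : (Fin m → Cantor) → (Fin k → Cantor)} → Computes φ Φ →
                  ∀ {xs j β} → Φ xs j <lex β → Locally (λ ys → Φ ys j <lex β) xs
computable-<lex computes {xs} {j} Φxs<β with <lex-open Φxs<β
... | N , prefix-open = locally-map (prefix-open _) (locally-∀< N λ q _ → computable-continuous computes xs j q)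

SGraph-functional : ∀ {α x b c} → SGraph α x b → SGraph α x c → b ≡ c
SGraph-functional {b = false} {false} _ _ = refl
SGraph-functional {b = true}  {true}  _ _ = refl
SGraph-functional {b = false} {true}  x<α x≥α = contradiction x≥α (<lex⇒≱lex x<α)
SGraph-functional {b = true}  {false} x≥α x<α = contradiction x≥α (<lex⇒≱lex x<α)

SGraph-cong : ∀ {α x y} b → (∀ q → x q ≡ y q) → SGraph α x b → SGraph α y b
SGraph-cong false x≗y (p , x≡α , xp≡0 , αp≡1) =
  p , (λ q q<p → trans (sym (x≗y q)) (x≡α q q<p)) , trans (sym (x≗y p)) xp≡0 , αp≡1
SGraph-cong true x≗y (inj₁ x≗α) = inj₁ λ q → trans (sym (x≗y q)) (x≗α q)
SGraph-cong true x≗y (inj₂ (p , α≡x , αp≡0 , xp≡1)) =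
  inj₂ (p , (λ q q<p → trans (α≡x q q<p) (x≗y q)) , αp≡0 , trans (sym (x≗y p)) xp≡1)

SGraph-¬¬total : ∀ α x → ¬ ¬ Σ Bool (SGraph α x)
SGraph-¬¬total α x ¬graph = ¬graph (true , inj₁ (<-rec _ agreeAt))
  where
  agreeAt : ∀ q → (∀ {r} → r < q → x r ≡ α r) → x q ≡ α q
  agreeAt q below with x q in xq | α q in αq
  ... | false | false = refl
  ... | true  | true  = refl
  ... | false | true  = contradiction (false , q , (λ _ → below) , xq , αq) ¬graph
  ... | true  | false = contradiction (true , inj₂ (q , (λ _ r<q → sym (below r<q)) , αq , xq)) ¬graph

SGraph-zero : ∀ {α x p b} → (∀ q → x q ≡ false) → α p ≡ true → SGraph α x b → b ≡ false
SGraph-zero {b = false} _ _ _ = refl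
SGraph-zero {p = p} {true} x≡0 αp≡1 (inj₁ x≗α) with trans (sym (x≡0 p)) (trans (x≗α p) αp≡1)
... | ()
SGraph-zero {b = true} x≡0 _ (inj₂ (q , _ , _ , xq≡1)) with trans (sym (x≡0 q)) xq≡1
... | ()

lowerAt : ℕ → Cantor → Cantor
lowerAt p α q with q ≟ p
... | yes _ = false
... | no  _ = α q

lowerAt-below : ∀ p α q → q < p → lowerAt p α q ≡ α q
lowerAt-below p α q q<p with q ≟ p
... | yes refl = contradiction q<p (n≮n q)
... | no  _    = refl

lowerAt-at : ∀ p α → lowerAt p α p ≡ false
lowerAt-at p α with p ≟ p
... | yes _   = refl
... | no  p≢p = contradiction refl p≢p

lowerAt-<lex : ∀ {p α} → α p ≡ true → lowerAt p α <lex α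
lowerAt-<lex {p} {α} αp≡1 = p , lowerAt-below p α , lowerAt-at p α , αp≡1

updateAt-agree : ∀ {m N} (xs : Fin m → Cantor) i {f : Cantor → Cantor} →
                 (∀ y q → q < N → f y q ≡ y q) → Agree N xs (updateAt xs i f)
updateAt-agree xs i f≈id j q q<N with j Fin.≟ i
... | yes refl = sym (trans (cong-app (updateAt-updates i xs) q) (f≈id (xs i) q q<N))
... | no  j≢i  = sym (cong-app (updateAt-minimal j i xs j≢i) q)

xorAll-cong : ∀ m {bs cs : Fin m → Bool} → (∀ i → bs i ≡ cs i) → xorAll m bs ≡ xorAll m cs
xorAll-cong zero    _     = refl
xorAll-cong (suc m) bs≗cs = cong₂ _xor_ (bs≗cs zero) (xorAll-cong m (λ i → bs≗cs (suc i)))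

xorAll-updateAt-not : ∀ {m} (bs : Fin m → Bool) i → xorAll m (updateAt bs i not) ≡ not (xorAll m bs)
xorAll-updateAt-not {suc m} bs zero    = sym (not-distribˡ-xor (bs zero) _)
xorAll-updateAt-not {suc m} bs (suc i) =
  trans (cong (bs zero xor_) (xorAll-updateAt-not (λ j → bs (suc j)) i))
        (sym (not-distribʳ-xor (bs zero) _))

xorAll-last : ∀ n (bs : Fin (suc n) → Bool) →
              xorAll (suc n) bs ≡ xorAll n (λ i → bs (inject₁ i)) xor bs (fromℕ n)
xorAll-last zero    bs = xor-comm (bs zero) false
xorAll-last (suc n) bs =
  trans (cong (bs zero xor_) (xorAll-last n (λ i → bs (suc i)))) (sym (xor-assoc (bs zero) _ _))

sXor-functional : ∀ {m αs xs b} {bs : Fin m → Bool} → sXor m αs xs b →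
                  (∀ i → SGraph (αs i) (xs i) (bs i)) → b ≡ xorAll m bs
sXor-functional {m} (cs , xs∈cs , refl) xs∈bs =
  xorAll-cong m λ i → SGraph-functional (xs∈cs i) (xs∈bs i)

¬¬-choice : ∀ {n} {Q : Fin n → Bool → Set} → (∀ j → ¬ ¬ Σ Bool (Q j)) →
            ¬ ¬ Σ (Vec Bool n) λ bs → ∀ j → Q j (lookup bs j)
¬¬-choice {zero}  _ = return ([] , λ ())
¬¬-choice {suc n} choose =
  choose zero >>= λ (b , qb) →
  ¬¬-choice (λ j → choose (suc j)) >>= λ (bs , qbs) →
  return (b ∷ bs , λ { zero → qb ; (suc j) → qbs j })

SGraphs : ∀ {m} → (Fin m → Cantor) → (Fin m → Cantor) → Vec Bool m → Set
SGraphs αs xs bs = ∀ i → SGraph (αs i) (xs i) (lookup bs i)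

SGraphs-¬¬total : ∀ {m} (αs xs : Fin m → Cantor) → ¬ ¬ Σ (Vec Bool m) (SGraphs αs xs)
SGraphs-¬¬total αs xs = ¬¬-choice λ i → SGraph-¬¬total (αs i) (xs i)

sXor-flip : ∀ {m} {αs xs ys : Fin m → Cantor} {bs cs} i → SGraphs αs xs bs → SGraphs αs ys cs →
            xs i ≡ αs i → ys i <lex αs i → (∀ j → j ≢ i → ys j ≡ xs j) →
            xorAll m (lookup cs) ≡ not (xorAll m (lookup bs))
sXor-flip {m} {bs = bs} {cs} i xs∈bs ys∈cs xsi≡αi ysi<αi ys≡xs =
  trans (xorAll-cong m cs≗bs′) (xorAll-updateAt-not (lookup bs) i)
  where
  cs≗bs′ : ∀ j → lookup cs j ≡ updateAt (lookup bs) i not j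
  cs≗bs′ j with j Fin.≟ i
  ... | yes refl = begin
    lookup cs i        ≡⟨ SGraph-functional (ys∈cs i) ysi<αi ⟩
    not true           ≡⟨ cong not (SGraph-functional (inj₁ λ q → cong-app xsi≡αi q) (xs∈bs i)) ⟩
    not (lookup bs i)  ≡⟨ sym (updateAt-updates i (lookup bs)) ⟩
    updateAt (lookup bs) i not i ∎
    where open ≡-Reasoning
  ... | no j≢i = trans
    (SGraph-functional (ys∈cs j) (SGraph-cong (lookup bs j) (λ q → sym (cong-app (ys≡xs j j≢i) q)) (xs∈bs j)))
    (sym (updateAt-minimal j i (lookup bs) j≢i))

⊆∧≢⇒⊂ : ∀ {n} {p q : Subset n} → p ⊆ q → p ≢ q → p ⊂ q
⊆∧≢⇒⊂ {n} {p} {q} p⊆q p≢q = p⊆q , outsider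
  where
  q⊈p : Σ (Fin n) λ x → ¬ (x ∈ q → x ∈ p)
  q⊈p = Fin.¬∀⟶∃¬ n (λ x → x ∈ q → x ∈ p) (λ x → (x ∈? q) →-dec (x ∈? p))
          λ q⊆p → p≢q (⊆-antisym p⊆q (q⊆p _))
  outsider : Σ (Fin n) λ x → x ∈ q × x ∉ p
  outsider with q⊈p
  ... | x , ¬q⇒p with x ∈? q
  ...   | yes x∈q = x , x∈q , λ x∈p → ¬q⇒p λ _ → x∈p
  ...   | no  x∉q = contradiction (λ x∈q → contradiction x∈q x∉q) ¬q⇒p

sXor-init-≤sW : ∀ n (αs : Fin (suc n) → Cantor) → Σ ℕ (λ p → αs (fromℕ n) p ≡ true) →
                sXor n (λ i → αs (inject₁ i)) ≤sW sXor (suc n) αs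
sXor-init-≤sW n αs (p , αp≡1) = O , padded , P zero , (λ _ _ _ → eO) , reduce
  where
  -- The last coordinate is out of range of xs, so toOracle makes it the zero sequence.
  padded : (Fin n → Cantor) → Fin (suc n) → Cantor
  padded xs i = toOracle xs (toℕ i)

  padded-init : ∀ xs i q → padded xs (inject₁ i) q ≡ xs i q
  padded-init xs i q = trans (cong (λ l → toOracle xs l q) (Fin.toℕ-inject₁ i)) (toOracle-toℕ xs i q)

  padded-last : ∀ xs q → padded xs (fromℕ n) q ≡ false
  padded-last xs q = trans (cong (λ l → toOracle xs l q) (Fin.toℕ-fromℕ n)) (toOracle-outside xs q)

  reduce : ∀ xs b → sXor (suc n) αs (padded xs) b →
           Σ Bool λ c → Eval noOracle (P zero) (bitℕ b ∷ []) (bitℕ c) ×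
                        sXor n (λ i → αs (inject₁ i)) xs c
  reduce xs _ (bs , padded∈bs , refl) = _ , eP , init , xs∈init , xor-init
    where
    init : Fin n → Bool
    init i = bs (inject₁ i)
    xs∈init : ∀ i → SGraph (αs (inject₁ i)) (xs i) (init i)
    xs∈init i = SGraph-cong (init i) (padded-init xs i) (padded∈bs (inject₁ i))
    last-zero : bs (fromℕ n) ≡ false
    last-zero = SGraph-zero (padded-last xs) αp≡1 (padded∈bs (fromℕ n))
    xor-init : xorAll n init ≡ xorAll (suc n) bs
    xor-init = begin
      xorAll n init                    ≡⟨ sym (xor-identityʳ _) ⟩
      xorAll n init xor false          ≡⟨ cong (xorAll n init xor_) (sym last-zero) ⟩
      xorAll n init xor bs (fromℕ n)   ≡⟨ sym (xorAll-last n bs) ⟩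
      xorAll (suc n) bs                ∎
      where open ≡-Reasoning

module NoReduction {k m} (k<m : k < m) (αs : Fin m → Cantor) (proper : ∀ i → Proper (αs i))
                   (βs : Fin k → Cantor) {φ} (Φ : (Fin m → Cantor) → (Fin k → Cantor)) (ψ : PR 1)
                   (computes : Computes φ Φ)
                   (reduces : ∀ xs b → sXor k βs (Φ xs) b →
                              Σ Bool λ c → Eval (toOracle xs) ψ (bitℕ b ∷ []) (bitℕ c) × sXor m αs xs c)
                   where

  record Snapshot (xs : Fin m → Cantor) : Set where
    field
      bs     : Vec Bool m
      xs∈bs  : SGraphs αs xs bs
      ds     : Subset k
      Φxs∈ds : SGraphs βs (Φ xs) ds

  open Snapshot

  take-snapshot : ∀ xs → ¬ ¬ Snapshot xs
  take-snapshot xs =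
    SGraphs-¬¬total αs xs >>= λ (bs , xs∈bs) →
    SGraphs-¬¬total βs (Φ xs) >>= λ (ds , Φxs∈ds) →
    return (record { bs = bs ; xs∈bs = xs∈bs ; ds = ds ; Φxs∈ds = Φxs∈ds })

  Stable : ∀ {xs} → Snapshot xs → (Fin m → Cantor) → Set
  Stable snap ys =
    Eval (toOracle ys) ψ (bitℕ (xorAll k (lookup (ds snap))) ∷ []) (bitℕ (xorAll m (lookup (bs snap))))
    × (∀ j → j ∉ ds snap → Φ ys j <lex βs j)

  stable : ∀ {xs} (snap : Snapshot xs) → Locally (Stable snap) xs
  stable {xs} snap = locally-zipWith _,_ (locally-toOracle (eval-continuous output)) (locally-∀Fin outside)
    where
    output : Eval (toOracle xs) ψ (bitℕ (xorAll k (lookup (ds snap))) ∷ []) (bitℕ (xorAll m (lookup (bs snap))))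
    output with reduces xs _ (lookup (ds snap) , Φxs∈ds snap , refl)
    ... | c , ψ↦c , xs∈c rewrite sXor-functional xs∈c (xs∈bs snap) = ψ↦c
    outside : ∀ j → Locally (λ ys → j ∉ ds snap → Φ ys j <lex βs j) xs
    outside j with lookup (ds snap) j in dsj | Φxs∈ds snap j
    ... | true  | _     = everywhere⇒locally λ _ j∉ds → contradiction (lookup⇒[]= j (ds snap) dsj) j∉ds
    ... | false | Φxs<β = locally-map (λ Φys<β _ → Φys<β) (computable-<lex computes Φxs<β)

  shrink : ∀ {xs} (snap : Snapshot xs) i → xs i ≡ αs i →
           ¬ ¬ Σ (Fin m → Cantor) λ ys → (∀ j → j ≢ i → ys j ≡ xs j) ×
                                         Σ (Snapshot ys) λ snap′ → ds snap′ ⊂ ds snap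
  shrink {xs} snap i xsi≡αi with stable snap
  ... | N , near⇒stable with proper i N
  ... | p , N≤p , αip≡1 = take-snapshot ys >>= λ snap′ →
    return (ys , ys≡xs , snap′ , ⊆∧≢⇒⊂ (shrunk snap′) (changed snap′))
    where
    ys : Fin m → Cantor
    ys = updateAt xs i (lowerAt p)
    ys≡xs : ∀ j → j ≢ i → ys j ≡ xs j
    ys≡xs j j≢i = updateAt-minimal j i xs j≢i
    ys-stable : Stable snap ys
    ys-stable = near⇒stable ys (agree-≤ N≤p (updateAt-agree xs i (lowerAt-below p)))
    ysi<αi : ys i <lex αs i
    ysi<αi rewrite updateAt-updates i {lowerAt p} xs | xsi≡αi = lowerAt-<lex αip≡1
    shrunk : ∀ snap′ → ds snap′ ⊆ ds snap
    shrunk snap′ {j} j∈ds′ with j ∈? ds snap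
    ... | yes j∈ds = j∈ds
    ... | no  j∉ds = contradiction (subst (SGraph _ _) ([]=⇒lookup j∈ds′) (Φxs∈ds snap′ j))
                                   (<lex⇒≱lex (proj₂ ys-stable j j∉ds))
    changed : ∀ snap′ → ds snap′ ≢ ds snap
    changed snap′ refl = not-¬ refl (bitℕ-injective (eval-deterministic (proj₁ ys-stable) ψ↦flipped))
      where
      ψ↦flipped : Eval (toOracle ys) ψ (bitℕ (xorAll k (lookup (ds snap))) ∷ [])
                                       (bitℕ (not (xorAll m (lookup (bs snap)))))
      ψ↦flipped = subst (λ b → Eval (toOracle ys) ψ _ (bitℕ b))
                        (sXor-flip {bs = bs snap} {cs = bs snap′} i (xs∈bs snap) (xs∈bs snap′)
                                   xsi≡αi ysi<αi ys≡xs)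
                        (proj₁ (locally-centre (stable snap′)))

  record Stage (s : ℕ) : Set where
    field
      xs        : Fin m → Cantor
      untouched : ∀ i → s ≤ toℕ i → xs i ≡ αs i
      snapshot  : Snapshot xs
      bound     : ∣ ds snapshot ∣ + s ≤ k

  stage-zero : ¬ ¬ Stage 0
  stage-zero = take-snapshot αs >>= λ snap → return (record
    { xs = αs ; untouched = λ _ _ → refl ; snapshot = snap
    ; bound = ≤-trans (≤-reflexive (+-identityʳ _)) (∣p∣≤n (ds snap)) })

  stage-suc : ∀ {s} → s < m → Stage s → ¬ ¬ Stage (suc s)
  stage-suc {s} s<m st = shrink snapshot i (untouched i (≤-reflexive (sym (Fin.toℕ-fromℕ< s<m))))
    >>= λ (ys , ys≡xs , snap′ , ds′⊂ds) → return (record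
      { xs = ys
      ; untouched = λ j s<j → trans (ys≡xs j (fresh s<j)) (untouched j (<⇒≤ s<j))
      ; snapshot = snap′
      ; bound = ≤-trans (≤-reflexive (+-suc _ s))
                        (≤-trans (+-monoˡ-≤ s (p⊂q⇒∣p∣<∣q∣ ds′⊂ds)) bound) })
    where
    open Stage st
    i : Fin m
    i = fromℕ< s<m
    fresh : ∀ {j} → s < toℕ j → j ≢ i
    fresh s<j refl = <⇒≢ s<j (sym (Fin.toℕ-fromℕ< s<m))

  stage : ∀ s → s ≤ m → ¬ ¬ Stage s
  stage zero    _     = stage-zero
  stage (suc s) s<m = stage s (<⇒≤ s<m) >>= stage-suc s<m

  absurd : ⊥
  absurd = stage m ≤-refl λ st → <⇒≱ k<m (m+n≤o⇒n≤o _ (Stage.bound st))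

sXor-≰W : ∀ {k m} → k < m → (αs : Fin m → Cantor) → (∀ i → Proper (αs i)) →
          (βs : Fin k → Cantor) → ¬ (sXor m αs ≤W sXor k βs)
sXor-≰W k<m αs proper βs (_ , Φ , ψ , computes , reduces) =
  NoReduction.absurd k<m αs proper βs Φ ψ computes reduces

mainTheorem2 : (n : ℕ) → 0 < n → (αs : Fin (suc n) → Cantor) → (∀ i → Proper (αs i)) →
    (sXor n (λ i → αs (inject₁ i)) ≤sW sXor (suc n) αs)
    × ¬ (sXor (suc n) αs ≤W sXor n (λ i → αs (inject₁ i)))
mainTheorem2 n _ αs proper = sXor-init-≤sW n αs last-has-one , sXor-≰W (n<1+n n) αs proper _
  where
  last-has-one : Σ ℕ λ p → αs (fromℕ n) p ≡ true
  last-has-one with proper (fromℕ n) 0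
  ... | p , _ , αp≡1 = p , αp≡1
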